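{- Let $a$ be a positive integer and, for integers $j$, let $\lambda_j=\left\lfloor \frac{j^2}{a}\right\rfloor$. Then the square Frobenius number $r_2(a,a+1)$ equals $(a-j_0)^2$, where $j_0$ is the smallest integer $j$ with $1\le j<a$ such that $(j+1)^2>(\lambda_j+1)(a+1)$.
   Context: For coprime positive integers $m,n$, $r_2(m,n)$ denotes the largest perfect square that cannot be written as $mx+ny$ with $x,y$ nonnegative integers. -}

module Defs where

open import Data.Nat using (ℕ; _+_; _*_; _≤_; _^_)
open import Data.Product using (∃-syntax; _×_)
open import Relation.Nullary using (¬_)
open import Relation.Binary.PropositionalEquality using (_≡_)

Representable : ℕ → ℕ → ℕ → Set
Representable m n k = ∃[ x ] ∃[ y ] m * x + n * y ≡ k

IsPerfectSquare : ℕ → Set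
IsPerfectSquare k = ∃[ t ] t ^ 2 ≡ k

IsSquareFrobenius : ℕ → ℕ → ℕ → Set
IsSquareFrobenius m n N =
  IsPerfectSquare N × ¬ Representable m n N ×
  (∀ k → IsPerfectSquare k → ¬ Representable m n k → k ≤ N)

{-# OPTIONS --safe #-}
module Submission where

-- With t + j = a we have t² + 2ja = j² + a², so t² and j² leave the same
-- remainder mod a while their quotients differ by a - 2j.  A number n is a
-- nonnegative combination of a and a + 1 exactly when n mod a ≤ n div a, so
-- t² is non-representable exactly when j satisfies the inequality
-- (⌊j²/a⌋ + 1)(a + 1) < (j + 1)².  Squares t² with t ≥ a are always
-- representable, hence the largest non-representable square is (a - j)² for
-- the least such j.

open import Defs
open import Data.Nat using (ℕ; zero; suc; _+_; _*_; _∸_; _^_; _≤_; _<_; _/_; _%_; NonZero; z≤n; z<s)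
open import Data.Nat.Properties
open import Data.Nat.DivMod
open import Data.Nat.Divisibility using (divides-refl)
open import Data.Nat.Tactic.RingSolver using (solve-∀)
open import Data.Product using (_,_)
open import Function using (_∘_)
open import Function.Bundles using (_⇔_; mk⇔; Equivalence)
open import Function.Properties.Equivalence using () renaming (trans to ⇔-trans; sym to ⇔-sym)
open import Function.Related.TypeIsomorphisms using (¬-cong-⇔)
open import Relation.Nullary using (¬_)
open import Relation.Binary.PropositionalEquality
  using (_≡_; refl; sym; trans; cong; subst; subst₂; module ≡-Reasoning)

open Equivalence using (to; from)

≰⇔> : ∀ {m n} → (¬ m ≤ n) ⇔ n < m
≰⇔> = mk⇔ ≰⇒> <⇒≱

<⇔+-<-+ : ∀ k {m n} → m < n ⇔ m + k < n + k
<⇔+-<-+ k = mk⇔ (+-monoˡ-< k) (+-cancelʳ-< k _ _)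

m^2≡m*m : ∀ m → m ^ 2 ≡ m * m
m^2≡m*m m = cong (m *_) (*-identityʳ m)

[m+1]^2≡m^2+2m+1 : ∀ m → (m + 1) ^ 2 ≡ m ^ 2 + 2 * m + 1
[m+1]^2≡m^2+2m+1 m rewrite m^2≡m*m (m + 1) | m^2≡m*m m = expand m
  where
  expand : ∀ m → (m + 1) * (m + 1) ≡ m * m + 2 * m + 1
  expand = solve-∀

m^2+2n[m+n]≡n^2+[m+n]*[m+n] : ∀ m n → m ^ 2 + 2 * n * (m + n) ≡ n ^ 2 + (m + n) * (m + n)
m^2+2n[m+n]≡n^2+[m+n]*[m+n] m n rewrite m^2≡m*m m | m^2≡m*m n = expand m n
  where
  expand : ∀ m n → m * m + 2 * n * (m + n) ≡ n * n + (m + n) * (m + n)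
  expand = solve-∀

a*x+[a+1]*y≡y+[x+y]*a : ∀ a x y → a * x + (a + 1) * y ≡ y + (x + y) * a
a*x+[a+1]*y≡y+[x+y]*a = solve-∀

[q+1][a+1]<[j+1]^2⇔q+a<r+2j : ∀ a j q r → j ^ 2 ≡ r + q * a →
  (q + 1) * (a + 1) < (j + 1) ^ 2 ⇔ q + a < r + 2 * j
[q+1][a+1]<[j+1]^2⇔q+a<r+2j a j q r j²≡r+qa = ⇔-sym (subst₂ (λ x y → q + a < r + 2 * j ⇔ x < y) lhs≡ rhs≡
                                 (<⇔+-<-+ (q * a + 1)))
  where
  open ≡-Reasoning
  lhs≡ : q + a + (q * a + 1) ≡ (q + 1) * (a + 1)
  lhs≡ = expand q a
    where
    expand : ∀ q a → q + a + (q * a + 1) ≡ (q + 1) * (a + 1)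
    expand = solve-∀
  rhs≡ : r + 2 * j + (q * a + 1) ≡ (j + 1) ^ 2
  rhs≡ = begin
    r + 2 * j + (q * a + 1) ≡⟨ rearrange r (2 * j) (q * a) ⟩
    r + q * a + 2 * j + 1   ≡⟨ cong (λ s → s + 2 * j + 1) (sym j²≡r+qa) ⟩
    j ^ 2 + 2 * j + 1       ≡⟨ sym ([m+1]^2≡m^2+2m+1 j) ⟩
    (j + 1) ^ 2             ∎
    where
    rearrange : ∀ r s p → r + s + (p + 1) ≡ r + p + s + 1
    rearrange = solve-∀

module _ (a : ℕ) .{{_ : NonZero a}} where

  [m+ka]/a≡m/a+k : ∀ m k → (m + k * a) / a ≡ m / a + k
  [m+ka]/a≡m/a+k m k = trans (+-distrib-/-∣ʳ m (divides-refl k)) (cong (m / a +_) (m*n/n≡m k a))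

  m+ka≡n+la⇒m%a≡n%a : ∀ m k n l → m + k * a ≡ n + l * a → m % a ≡ n % a
  m+ka≡n+la⇒m%a≡n%a m k n l eq = begin
    m % a               ≡⟨ sym ([m+kn]%n≡m%n m k a) ⟩
    (m + k * a) % a     ≡⟨ cong (_% a) eq ⟩
    (n + l * a) % a     ≡⟨ [m+kn]%n≡m%n n l a ⟩
    n % a               ∎
    where open ≡-Reasoning

  m+ka≡n+la⇒m/a+k≡n/a+l : ∀ m k n l → m + k * a ≡ n + l * a → m / a + k ≡ n / a + l
  m+ka≡n+la⇒m/a+k≡n/a+l m k n l eq = begin
    m / a + k           ≡⟨ sym ([m+ka]/a≡m/a+k m k) ⟩
    (m + k * a) / a     ≡⟨ cong (_/ a) eq ⟩
    (n + l * a) / a     ≡⟨ [m+ka]/a≡m/a+k n l ⟩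
    n / a + l           ∎
    where open ≡-Reasoning

  -- a x + (a + 1) y = y + (x + y) a: the representable numbers are exactly
  -- the q a + r with r ≤ q, and with r < a this is division by a.
  representable⇔%≤/ : ∀ n → Representable a (a + 1) n ⇔ n % a ≤ n / a
  representable⇔%≤/ n = mk⇔ representable⇒%≤/ %≤/⇒representable
    where
    representable⇒%≤/ : Representable a (a + 1) n → n % a ≤ n / a
    representable⇒%≤/ (x , y , refl) = begin
        (a * x + (a + 1) * y) % a ≡⟨ cong (_% a) (a*x+[a+1]*y≡y+[x+y]*a a x y) ⟩
        (y + (x + y) * a) % a     ≡⟨ [m+kn]%n≡m%n y (x + y) a ⟩
        y % a                     ≤⟨ m%n≤m y a ⟩
        y                         ≤⟨ m≤n+m y (y / a + x) ⟩
        y / a + x + y             ≡⟨ +-assoc (y / a) x y ⟩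
        y / a + (x + y)           ≡⟨ sym ([m+ka]/a≡m/a+k y (x + y)) ⟩
        (y + (x + y) * a) / a     ≡⟨ cong (_/ a) (sym (a*x+[a+1]*y≡y+[x+y]*a a x y)) ⟩
        (a * x + (a + 1) * y) / a ∎
      where open ≤-Reasoning

    %≤/⇒representable : n % a ≤ n / a → Representable a (a + 1) n
    %≤/⇒representable r≤q = q ∸ r , r , (begin
        a * (q ∸ r) + (a + 1) * r ≡⟨ a*x+[a+1]*y≡y+[x+y]*a a (q ∸ r) r ⟩
        r + (q ∸ r + r) * a       ≡⟨ cong (λ s → r + s * a) (m∸n+n≡m r≤q) ⟩
        r + q * a                 ≡⟨ sym (m≡m%n+[m/n]*n n a) ⟩
        n                         ∎)
      where
      open ≡-Reasoning
      r = n % a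
      q = n / a

  representable-square-≥ : ∀ t → a ≤ t → Representable a (a + 1) (t ^ 2)
  representable-square-≥ t a≤t = from (representable⇔%≤/ (t ^ 2)) (begin
      t ^ 2 % a       ≤⟨ <⇒≤ (m%n<n (t ^ 2) a) ⟩
      a               ≤⟨ a≤t ⟩
      t               ≡⟨ sym (m*n/n≡m t a) ⟩
      t * a / a       ≤⟨ /-monoˡ-≤ a (*-monoʳ-≤ t (subst (a ≤_) (sym (*-identityʳ t)) a≤t)) ⟩
      t ^ 2 / a       ∎)
    where open ≤-Reasoning

  ¬representable-square⇒< : ∀ t → ¬ Representable a (a + 1) (t ^ 2) → t < a
  ¬representable-square⇒< t ¬rep = ≰⇒> (¬rep ∘ representable-square-≥ t)

  ¬representable-square⇔gap : ∀ t j → t + j ≡ a →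
    (¬ Representable a (a + 1) (t ^ 2)) ⇔ (j ^ 2 / a + 1) * (a + 1) < (j + 1) ^ 2
  ¬representable-square⇔gap t j refl =
    ⇔-trans (¬-cong-⇔ (representable⇔%≤/ (t ^ 2)))
      (⇔-trans ≰⇔>
        (⇔-trans (subst₂ (λ x y → t ^ 2 / a < t ^ 2 % a ⇔ x < y) /-eq (cong (_+ 2 * j) %-eq)
                   (<⇔+-<-+ (2 * j)))
          (⇔-sym ([q+1][a+1]<[j+1]^2⇔q+a<r+2j a j (j ^ 2 / a) (j ^ 2 % a) (m≡m%n+[m/n]*n (j ^ 2) a)))))
    where
    t²+2ja≡j²+aa : t ^ 2 + 2 * j * a ≡ j ^ 2 + a * a
    t²+2ja≡j²+aa = m^2+2n[m+n]≡n^2+[m+n]*[m+n] t j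
    %-eq : t ^ 2 % a ≡ j ^ 2 % a
    %-eq = m+ka≡n+la⇒m%a≡n%a (t ^ 2) (2 * j) (j ^ 2) a t²+2ja≡j²+aa
    /-eq : t ^ 2 / a + 2 * j ≡ j ^ 2 / a + a
    /-eq = m+ka≡n+la⇒m/a+k≡n/a+l (t ^ 2) (2 * j) (j ^ 2) a t²+2ja≡j²+aa

corollary7 : (a : ℕ) → .{{_ : NonZero a}} → (j₀ : ℕ) →
    1 ≤ j₀ → j₀ < a →
    ((j₀ ^ 2 / a) + 1) * (a + 1) < (j₀ + 1) ^ 2 →
    (∀ j → 1 ≤ j → j < a → ((j ^ 2 / a) + 1) * (a + 1) < (j + 1) ^ 2 → j₀ ≤ j) →
    IsSquareFrobenius a (a + 1) ((a ∸ j₀) ^ 2)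
corollary7 a j₀ _ j₀<a gap₀ minimal =
  (a ∸ j₀ , refl) ,
  from (¬representable-square⇔gap a (a ∸ j₀) j₀ (m∸n+n≡m (<⇒≤ j₀<a))) gap₀ ,
  λ { _ (t , refl) ¬rep → ^-monoˡ-≤ 2 (¬representable⇒≤ t ¬rep) }
  where
  ¬representable⇒≤ : ∀ t → ¬ Representable a (a + 1) (t ^ 2) → t ≤ a ∸ j₀
  ¬representable⇒≤ zero      _    = z≤n
  ¬representable⇒≤ t@(suc _) ¬rep = begin
    t       ≡⟨ sym (m∸[m∸n]≡n t≤a) ⟩
    a ∸ j   ≤⟨ ∸-monoʳ-≤ a (minimal j (m<n⇒0<n∸m t<a) (∸-monoʳ-< z<s t≤a) gap) ⟩
    a ∸ j₀  ∎
    where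
    open ≤-Reasoning
    t<a : t < a
    t<a = ¬representable-square⇒< a t ¬rep
    t≤a : t ≤ a
    t≤a = <⇒≤ t<a
    j : ℕ
    j = a ∸ t
    gap : (j ^ 2 / a + 1) * (a + 1) < (j + 1) ^ 2
    gap = to (¬representable-square⇔gap a t j (m+[n∸m]≡n t≤a)) ¬rep
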